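{- Let $A=(a_{i,j})$ be an $n\times n$ matrix over a field $\mathbb{F}$ of characteristic $2$. Then \[ \operatorname{per}(A)=\det(A)=\sum_{S\subseteq[n]}\prod_{i=1}^n\sum_{j\in S\ominus\{i\}}a_{i,j}. \] In particular, $\operatorname{Trank}(\operatorname{per}^n_{\mathbb{F}})=\operatorname{Trank}(\det^n_{\mathbb{F}})\le 2^n-n$.
   Context: $[n]=\{1,\dots,n\}$; $\ominus$ denotes symmetric difference of sets; empty sums are $0$. $\operatorname{per}(A)=\sum_{\sigma\in S_n}\prod_i a_{i,\sigma(i)}$. The determinant and permanent tensors are $\det^n_{\mathbb{F}}=\sum_{\sigma\in S_n}\operatorname{sgn}(\sigma)\mathbf{e}_{\sigma(1)}\otimes\cdots\otimes\mathbf{e}_{\sigma(n)}$ and $\operatorname{per}^n_{\mathbb{F}}=\sum_{\sigma\in S_n}\mathbf{e}_{\sigma(1)}\otimes\cdots\otimes\mathbf{e}_{\sigma(n)}$ in $(\mathbb{F}^n)^{\otimes n}$; $\operatorname{Trank}$ is tensor rank (least number of elementary tensors $\mathbf{v_1}\otimes\cdots\otimes\mathbf{v_n}$ summing to the tensor). -}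

module Defs where

open import Level using (Level; _⊔_)
open import Algebra.Bundles using (CommutativeRing)
open import Data.Nat as ℕ using (ℕ; zero; suc)
open import Data.Nat.Base using (_%_)
open import Data.Fin as Fin using (Fin; zero; suc)
open import Data.Fin.Properties using (_≟_; _<?_)
open import Data.Fin.Subset using (Subset; ⁅_⁆; inside; outside)
open import Data.Bool using (Bool; true; false; if_then_else_; _xor_; not; _∧_; _∨_)
open import Data.List as List using (List; []; _∷_; map; concatMap; filterᵇ; foldr; allFin)
open import Data.Bool.ListAction using (and)
open import Data.Vec as Vec using (Vec; lookup; zipWith)
open import Data.Product using (Σ; _×_; _,_)
open import Relation.Nullary using (¬_; does)

record Field (c ℓ : Level) : Set (Level.suc (c ⊔ ℓ)) where
  field
    commutativeRing : CommutativeRing c ℓ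
  open CommutativeRing commutativeRing public
  field
    1≉0     : ¬ (1# ≈ 0#)
    inverse : ∀ x → ¬ (x ≈ 0#) → Σ Carrier λ y → x * y ≈ 1#

Char2 : ∀ {c ℓ} → Field c ℓ → Set ℓ
Char2 F = 1# + 1# ≈ 0#
  where open Field F

allFuns : ∀ n m → List (Fin n → Fin m)
allFuns zero    m = (λ ()) ∷ []
allFuns (suc n) m =
  concatMap (λ f → map (λ k → λ { zero → k ; (suc i) → f i }) (allFin m))
            (allFuns n m)

allᵇ : ∀ n → (Fin n → Bool) → Bool
allᵇ n p = and (map p (allFin n))

-- σ : Fin n → Fin n is a permutation (injective, hence bijective)
isPerm : ∀ {n} → (Fin n → Fin n) → Bool
isPerm {n} σ = allᵇ n λ i → allᵇ n λ j → does (i ≟ j) ∨ not (does (σ i ≟ σ j))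

perms : ∀ n → List (Fin n → Fin n)
perms n = filterᵇ isPerm (allFuns n n)

countᵇ : List Bool → ℕ
countᵇ = foldr (λ b k → if b then suc k else k) 0

inversions : ∀ {n} → (Fin n → Fin n) → ℕ
inversions {n} σ =
  countᵇ (concatMap (λ i → map (λ j → does (i <? j) ∧ does (σ j <? σ i)) (allFin n)) (allFin n))

allSubsets : ∀ n → List (Subset n)
allSubsets zero    = Vec.[] ∷ []
allSubsets (suc n) = concatMap (λ s → (outside Vec.∷ s) ∷ (inside Vec.∷ s) ∷ []) (allSubsets n)

_⊖_ : ∀ {n} → Subset n → Subset n → Subset n
_⊖_ = zipWith _xor_

module _ {c ℓ} (R : CommutativeRing c ℓ) where
  open CommutativeRing R

  sumL : List Carrier → Carrier
  sumL = foldr _+_ 0#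

  prodL : List Carrier → Carrier
  prodL = foldr _*_ 1#

  Σ[<_] : ∀ n → (Fin n → Carrier) → Carrier
  Σ[< n ] f = sumL (map f (allFin n))

  ∏[<_] : ∀ n → (Fin n → Carrier) → Carrier
  ∏[< n ] f = prodL (map f (allFin n))

  Matrix : ℕ → Set c
  Matrix n = Fin n → Fin n → Carrier

  sgn : ∀ {n} → (Fin n → Fin n) → Carrier
  sgn σ = if does (inversions σ % 2 ℕ.≟ 0) then 1# else - 1#

  per : ∀ {n} → Matrix n → Carrier
  per {n} A = sumL (map (λ σ → ∏[< n ] λ i → A i (σ i)) (perms n))

  det : ∀ {n} → Matrix n → Carrier
  det {n} A = sumL (map (λ σ → sgn σ * (∏[< n ] λ i → A i (σ i))) (perms n))

  subsetFormula : ∀ {n} → Matrix n → Carrier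
  subsetFormula {n} A =
    sumL (map (λ S → ∏[< n ] λ i → Σ[< n ] λ j →
                 if lookup (S ⊖ ⁅ i ⁆) j then A i j else 0#)
              (allSubsets n))

  -- Tensors in (R^n)^{⊗ n}, given by coordinates w.r.t. the basis
  -- e_{f(1)} ⊗ ⋯ ⊗ e_{f(n)}, f : [n] → [n].

  Tensor : ℕ → Set c
  Tensor n = (Fin n → Fin n) → Carrier

  _≈ᵀ_ : ∀ {n} → Tensor n → Tensor n → Set ℓ
  T ≈ᵀ U = ∀ f → T f ≈ U f

  detTensor : ∀ n → Tensor n
  detTensor n f = if isPerm f then sgn f else 0#

  perTensor : ∀ n → Tensor n
  perTensor n f = if isPerm f then 1# else 0#

  elementary : ∀ {n} → (Fin n → Fin n → Carrier) → Tensor n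
  elementary {n} v f = ∏[< n ] λ k → v k (f k)

  -- T is a sum of (at most) r elementary tensors, i.e. Trank T ≤ r
  -- (zero summands are allowed, so "exactly r" = "at most r")
  RankLE : ∀ {n} → Tensor n → ℕ → Set (c ⊔ ℓ)
  RankLE {n} T r = Σ (Fin r → Fin n → Fin n → Carrier) λ vs →
                     T ≈ᵀ (λ f → Σ[< r ] λ t → elementary (vs t) f)

-- In characteristic 2 every sign is 1, so per = det and per^n = det^n.  Expanding
-- ∏ᵢ Σ_{j ∈ S ⊖ {i}} a_{ij} gives Σ_f ∏ᵢ a_{i,f(i)} over the maps f compatible with S,
-- i.e. with f(i) ∈ S ⊖ {i} for all i.  For fixed f this splits into one condition per
-- coordinate j of S, involving only the fibre f⁻¹(j), so the number of compatible S
-- is odd iff every fibre is nonempty and the fibre of a fixed point is a singleton,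
-- i.e. iff f is a permutation.  Read as tensors, the same count gives
-- per^n = Σ_S ⊗_k 1_{S ⊖ {k}}, and for S = {k} the k-th factor vanishes, leaving
-- 2^n − n elementary tensors.

module Submission where

open import Level using (0ℓ)
open import Algebra.Bundles using (CommutativeMonoid; CommutativeRing)
import Algebra.Properties.CommutativeSemigroup as CommutativeSemigroupProperties
open import Data.Bool using (Bool; true; false; if_then_else_; not; _∧_; _∨_; _xor_)
open import Data.Bool.Properties using (xor-∧-commutativeRing; xor-same; ∧-identityʳ)
open import Data.Fin using (Fin; zero; suc; punchOut)
open import Data.Fin.Subset using (Subset; outside; inside; ⁅_⁆; ⊥)
open import Data.Vec using ([]; _∷_; lookup)
import Data.Vec.Properties as Vec
open import Data.List as List using (List; []; _∷_; _++_; map; concatMap; filterᵇ; foldr; allFin)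
import Data.List.Properties as List
open import Data.Fin.Properties using (_≟_; any?; punchOut-injective; injective⇒≤)
open import Data.Nat as Nat using (ℕ; zero; suc; _^_; _∸_)
import Data.Nat.Properties as ℕ
open import Data.Product using (∃; _×_; _,_; proj₁; proj₂)
open import Function.Bundles using (_⇔_; mk⇔)
open import Function.Definitions using (Injective)
open import Relation.Nullary using (yes; no; contradiction; does)
open import Relation.Nullary.Decidable using (dec-true; dec-false)
open import Relation.Binary.PropositionalEquality as ≡ using (_≡_; _≢_)
import Relation.Binary.Reasoning.Setoid as SetoidReasoning

open import Defs

module ListSum {c ℓ} (M : CommutativeMonoid c ℓ) where
  open CommutativeMonoid M
  open CommutativeSemigroupProperties commutativeSemigroup using (interchange)
  open SetoidReasoning setoid

  ∑ : List Carrier → Carrier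
  ∑ = foldr _∙_ ε

  module _ {a} {A : Set a} where

    ∑-map-cong : {g h : A → Carrier} → (∀ x → g x ≈ h x) → ∀ xs → ∑ (map g xs) ≈ ∑ (map h xs)
    ∑-map-cong g≈h []       = refl
    ∑-map-cong g≈h (x ∷ xs) = ∙-cong (g≈h x) (∑-map-cong g≈h xs)

    ∑-map-ε : ∀ (xs : List A) → ∑ (map (λ _ → ε) xs) ≈ ε
    ∑-map-ε []       = refl
    ∑-map-ε (x ∷ xs) = trans (identityˡ _) (∑-map-ε xs)

    ∑-map-∙ : ∀ (g h : A → Carrier) xs → ∑ (map (λ x → g x ∙ h x) xs) ≈ ∑ (map g xs) ∙ ∑ (map h xs)
    ∑-map-∙ g h []       = sym (identityˡ ε)
    ∑-map-∙ g h (x ∷ xs) = trans (∙-congˡ (∑-map-∙ g h xs)) (interchange _ _ _ _)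

    ∑-filterᵇ : ∀ (g : A → Carrier) p xs →
      ∑ (map g (filterᵇ p xs)) ≈ ∑ (map (λ x → if p x then g x else ε) xs)
    ∑-filterᵇ g p []       = refl
    ∑-filterᵇ g p (x ∷ xs) with p x
    ... | true  = ∙-congˡ (∑-filterᵇ g p xs)
    ... | false = trans (∑-filterᵇ g p xs) (sym (identityˡ _))

    ∑-filterᵇ-not : ∀ {g : A → Carrier} (p : A → Bool) → (∀ x → p x ≡ true → g x ≈ ε) → ∀ xs →
      ∑ (map g (filterᵇ (λ x → not (p x)) xs)) ≈ ∑ (map g xs)
    ∑-filterᵇ-not p vanish []       = refl
    ∑-filterᵇ-not p vanish (x ∷ xs) with p x in px
    ... | true  = trans (∑-filterᵇ-not p vanish xs) (sym (trans (∙-congʳ (vanish x px)) (identityˡ _)))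
    ... | false = ∙-congˡ (∑-filterᵇ-not p vanish xs)

  ∑-++ : ∀ xs ys → ∑ (xs ++ ys) ≈ ∑ xs ∙ ∑ ys
  ∑-++ []       ys = sym (identityˡ _)
  ∑-++ (x ∷ xs) ys = trans (∙-congˡ (∑-++ xs ys)) (sym (assoc _ _ _))

  module _ {a b} {A : Set a} {B : Set b} where

    ∑-concatMap : ∀ (g : B → Carrier) (h : A → List B) xs →
      ∑ (map g (concatMap h xs)) ≈ ∑ (map (λ x → ∑ (map g (h x))) xs)
    ∑-concatMap g h []       = refl
    ∑-concatMap g h (x ∷ xs) = begin
      ∑ (map g (h x ++ concatMap h xs))           ≡⟨ ≡.cong ∑ (List.map-++ g (h x) _) ⟩
      ∑ (map g (h x) ++ map g (concatMap h xs))   ≈⟨ ∑-++ (map g (h x)) _ ⟩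
      ∑ (map g (h x)) ∙ ∑ (map g (concatMap h xs)) ≈⟨ ∙-congˡ (∑-concatMap g h xs) ⟩
      ∑ (map (λ x → ∑ (map g (h x))) (x ∷ xs))    ∎

    ∑-map-comm : ∀ (k : A → B → Carrier) xs ys →
      ∑ (map (λ x → ∑ (map (k x) ys)) xs) ≈ ∑ (map (λ y → ∑ (map (λ x → k x y) xs)) ys)
    ∑-map-comm k []       ys = sym (∑-map-ε ys)
    ∑-map-comm k (x ∷ xs) ys = begin
      ∑ (map (k x) ys) ∙ ∑ (map (λ x → ∑ (map (k x) ys)) xs)
        ≈⟨ ∙-congˡ (∑-map-comm k xs ys) ⟩
      ∑ (map (k x) ys) ∙ ∑ (map (λ y → ∑ (map (λ x → k x y) xs)) ys)
        ≈⟨ ∑-map-∙ (k x) _ ys ⟨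
      ∑ (map (λ y → ∑ (map (λ x → k x y) (x ∷ xs))) ys) ∎

𝔹 : CommutativeRing 0ℓ 0ℓ
𝔹 = xor-∧-commutativeRing

module RingSums {c ℓ} (R : CommutativeRing c ℓ) where
  open CommutativeRing R hiding (zero)
  open SetoidReasoning setoid
  open ListSum +-commutativeMonoid public
  module Π = ListSum *-commutativeMonoid

  ∏-suc : ∀ n (g : Fin (suc n) → Carrier) → ∏[< R ] (suc n) g ≡ g zero * ∏[< R ] n (λ i → g (suc i))
  ∏-suc n g = ≡.cong (λ gs → g zero * prodL R gs)
    (≡.trans (List.map-tabulate suc g) (≡.sym (List.map-tabulate (λ i → i) (λ i → g (suc i)))))

  ∏-zero : ∀ n (g : Fin n → Carrier) k → g k ≈ 0# → ∏[< R ] n g ≈ 0#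
  ∏-zero (suc n) g zero    gk≈0 = begin
    ∏[< R ] (suc n) g                   ≡⟨ ∏-suc n g ⟩
    g zero * ∏[< R ] n (λ i → g (suc i)) ≈⟨ *-congʳ gk≈0 ⟩
    0# * ∏[< R ] n (λ i → g (suc i))     ≈⟨ zeroˡ _ ⟩
    0#                                  ∎
  ∏-zero (suc n) g (suc k) gk≈0 = begin
    ∏[< R ] (suc n) g                   ≡⟨ ∏-suc n g ⟩
    g zero * ∏[< R ] n (λ i → g (suc i)) ≈⟨ *-congˡ (∏-zero n (λ i → g (suc i)) k gk≈0) ⟩
    g zero * 0#                         ≈⟨ zeroʳ _ ⟩
    0#                                  ∎

  module _ {a} {A : Set a} where

    ∑-distribˡ : ∀ x (g : A → Carrier) xs → x * ∑ (map g xs) ≈ ∑ (map (λ y → x * g y) xs)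
    ∑-distribˡ x g []       = zeroʳ x
    ∑-distribˡ x g (y ∷ xs) = trans (distribˡ x _ _) (+-congˡ (∑-distribˡ x g xs))

    ∑-distribʳ : ∀ x (g : A → Carrier) xs → ∑ (map g xs) * x ≈ ∑ (map (λ y → g y * x) xs)
    ∑-distribʳ x g []       = zeroˡ x
    ∑-distribʳ x g (y ∷ xs) = trans (distribʳ x _ _) (+-congˡ (∑-distribʳ x g xs))

  ∏-∑-allFuns : ∀ n m (h : Fin n → Fin m → Carrier) →
    ∏[< R ] n (λ i → Σ[< R ] m (h i)) ≈ ∑ (map (λ f → ∏[< R ] n λ i → h i (f i)) (allFuns n m))
  ∏-∑-allFuns zero    m h = sym (+-identityʳ 1#)
  ∏-∑-allFuns (suc n) m h = begin
    ∏[< R ] (suc n) (λ i → Σ[< R ] m (h i))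
      ≡⟨ ∏-suc n _ ⟩
    Σ[< R ] m (h zero) * ∏[< R ] n (λ i → Σ[< R ] m (h (suc i)))
      ≈⟨ *-congˡ (∏-∑-allFuns n m (λ i → h (suc i))) ⟩
    Σ[< R ] m (h zero) * ∑ (map tail (allFuns n m))
      ≈⟨ ∑-distribˡ _ tail (allFuns n m) ⟩
    ∑ (map (λ f → Σ[< R ] m (h zero) * tail f) (allFuns n m))
      ≈⟨ ∑-map-cong (λ f → ∑-distribʳ (tail f) (h zero) (allFin m)) (allFuns n m) ⟩
    ∑ (map (λ f → ∑ (map (λ k → h zero k * tail f) (allFin m))) (allFuns n m))
      ≈⟨ trans (∑-map-cong (λ f → trans (∑-map-cong (λ k → reflexive (≡.sym (∏-suc n _))) (allFin m))
                                        (reflexive (≡.cong ∑ (List.map-∘ (allFin m)))))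
                           (allFuns n m))
               (sym (∑-concatMap term _ (allFuns n m))) ⟩
    ∑ (map term (allFuns (suc n) m)) ∎
    where
    tail : (Fin n → Fin m) → Carrier
    tail f = ∏[< R ] n λ i → h (suc i) (f i)
    term : (Fin (suc n) → Fin m) → Carrier
    term f = ∏[< R ] (suc n) λ i → h i (f i)

  ∑-allSubsets-∏ : ∀ n (g : Fin n → Bool → Carrier) →
    ∑ (map (λ S → ∏[< R ] n λ j → g j (lookup S j)) (allSubsets n)) ≈ ∏[< R ] n (λ j → g j false + g j true)
  ∑-allSubsets-∏ zero    g = +-identityʳ 1#
  ∑-allSubsets-∏ (suc n) g = begin
    ∑ (map term (allSubsets (suc n)))
      ≈⟨ ∑-concatMap term _ (allSubsets n) ⟩
    ∑ (map (λ s → term (outside ∷ s) + (term (inside ∷ s) + 0#)) (allSubsets n))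
      ≈⟨ ∑-map-cong split (allSubsets n) ⟩
    ∑ (map (λ s → (g zero false + g zero true) * tail s) (allSubsets n))
      ≈⟨ ∑-distribˡ _ tail (allSubsets n) ⟨
    (g zero false + g zero true) * ∑ (map tail (allSubsets n))
      ≈⟨ *-congˡ (∑-allSubsets-∏ n (λ j → g (suc j))) ⟩
    (g zero false + g zero true) * ∏[< R ] n (λ j → g (suc j) false + g (suc j) true)
      ≡⟨ ∏-suc n _ ⟨
    ∏[< R ] (suc n) (λ j → g j false + g j true) ∎
    where
    term : Subset (suc n) → Carrier
    term S = ∏[< R ] (suc n) λ j → g j (lookup S j)
    tail : Subset n → Carrier
    tail s = ∏[< R ] n λ j → g (suc j) (lookup s j)
    split : ∀ s → term (outside ∷ s) + (term (inside ∷ s) + 0#) ≈ (g zero false + g zero true) * tail s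
    split s = begin
      term (outside ∷ s) + (term (inside ∷ s) + 0#)   ≈⟨ +-congˡ (+-identityʳ _) ⟩
      term (outside ∷ s) + term (inside ∷ s)          ≡⟨ ≡.cong₂ _+_ (∏-suc n _) (∏-suc n _) ⟩
      g zero false * tail s + g zero true * tail s    ≈⟨ distribʳ _ _ _ ⟨
      (g zero false + g zero true) * tail s           ∎

  ⟦_⟧ : Bool → Carrier
  ⟦ b ⟧ = if b then 1# else 0#

  ⟦⟧-if : ∀ b x → (if b then x else 0#) ≈ ⟦ b ⟧ * x
  ⟦⟧-if true  x = sym (*-identityˡ x)
  ⟦⟧-if false x = sym (zeroˡ x)

  ⟦⟧-∏ : ∀ {a} {A : Set a} (p : A → Bool) xs → ⟦ prodL 𝔹 (map p xs) ⟧ ≈ prodL R (map (λ x → ⟦ p x ⟧) xs)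
  ⟦⟧-∏ p []       = refl
  ⟦⟧-∏ p (x ∷ xs) with p x
  ... | true  = trans (⟦⟧-∏ p xs) (sym (*-identityˡ _))
  ... | false = sym (zeroˡ _)

  ∏-if : ∀ n (b : Fin n → Bool) (a : Fin n → Carrier) →
    ∏[< R ] n (λ i → if b i then a i else 0#) ≈ ⟦ allᵇ n b ⟧ * ∏[< R ] n a
  ∏-if n b a = begin
    ∏[< R ] n (λ i → if b i then a i else 0#)   ≈⟨ Π.∑-map-cong (λ i → ⟦⟧-if (b i) (a i)) (allFin n) ⟩
    ∏[< R ] n (λ i → ⟦ b i ⟧ * a i)             ≈⟨ Π.∑-map-∙ (λ i → ⟦ b i ⟧) a (allFin n) ⟩
    ∏[< R ] n (λ i → ⟦ b i ⟧) * ∏[< R ] n a     ≈⟨ *-congʳ (⟦⟧-∏ b (allFin n)) ⟨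
    ⟦ allᵇ n b ⟧ * ∏[< R ] n a                   ∎

module _ where
  open RingSums 𝔹 using (∏-suc; ∏-zero)

  ∧≡true : ∀ {a b} → a ∧ b ≡ true → a ≡ true × b ≡ true
  ∧≡true {true} {true} _ = ≡.refl , ≡.refl

  allᵇ-true⁺ : ∀ {n} {p : Fin n → Bool} → (∀ i → p i ≡ true) → allᵇ n p ≡ true
  allᵇ-true⁺ {zero}      _   = ≡.refl
  allᵇ-true⁺ {suc n} {p} all = ≡.trans (∏-suc n p) (≡.cong₂ _∧_ (all zero) (allᵇ-true⁺ (λ i → all (suc i))))

  allᵇ-true⁻ : ∀ {n} {p : Fin n → Bool} → allᵇ n p ≡ true → ∀ i → p i ≡ true
  allᵇ-true⁻ {suc n} {p} all i with ∧≡true {p zero} {allᵇ n (λ i → p (suc i))} (≡.trans (≡.sym (∏-suc n p)) all)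
  allᵇ-true⁻ {suc n} {p} all zero    | head , _    = head
  allᵇ-true⁻ {suc n} {p} all (suc i) | _    , tail = allᵇ-true⁻ tail i

  allᵇ-false⁺ : ∀ {n} {p : Fin n → Bool} i → p i ≡ false → allᵇ n p ≡ false
  allᵇ-false⁺ {n} {p} = ∏-zero n p

  lookup-allᵇ : ∀ {n} (S : Subset n) k → lookup S k ≡ allᵇ n (λ j → not (does (k ≟ j)) ∨ lookup S j)
  lookup-allᵇ {suc n} (x ∷ S) zero    = ≡.sym (begin
    allᵇ (suc n) (λ j → not (does (zero ≟ j)) ∨ lookup (x ∷ S) j)
      ≡⟨ ∏-suc n (λ j → not (does (zero ≟ j)) ∨ lookup (x ∷ S) j) ⟩
    x ∧ allᵇ n (λ _ → true)
      ≡⟨ ≡.cong (x ∧_) (allᵇ-true⁺ {n} (λ _ → ≡.refl)) ⟩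
    x ∧ true
      ≡⟨ ∧-identityʳ x ⟩
    x ∎)
    where open ≡.≡-Reasoning
  lookup-allᵇ {suc n} (x ∷ S) (suc k) =
    ≡.trans (lookup-allᵇ S k) (≡.sym (∏-suc n (λ j → not (does (suc k ≟ j)) ∨ lookup (x ∷ S) j)))

true⇔true⇒≡ : ∀ {a b} → (a ≡ true → b ≡ true) → (b ≡ true → a ≡ true) → a ≡ b
true⇔true⇒≡ {false} {false} _ _ = ≡.refl
true⇔true⇒≡ {false} {true}  _ b⇒a = b⇒a ≡.refl
true⇔true⇒≡ {true}  {false} a⇒b _ = ≡.sym (a⇒b ≡.refl)
true⇔true⇒≡ {true}  {true}  _ _ = ≡.refl

lookup-⁅⁆ : ∀ {n} (i j : Fin n) → lookup ⁅ i ⁆ j ≡ does (i ≟ j)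
lookup-⁅⁆ zero    zero    = ≡.refl
lookup-⁅⁆ zero    (suc j) = Vec.lookup-replicate j outside
lookup-⁅⁆ (suc i) zero    = ≡.refl
lookup-⁅⁆ (suc i) (suc j) = lookup-⁅⁆ i j

lookup-⊖ : ∀ {n} (S T : Subset n) j → lookup (S ⊖ T) j ≡ lookup S j xor lookup T j
lookup-⊖ S T j = Vec.lookup-zipWith _xor_ j S T

⊖-self : ∀ {n} (S : Subset n) → S ⊖ S ≡ ⊥
⊖-self []      = ≡.refl
⊖-self (x ∷ S) = ≡.cong₂ _∷_ (xor-same x) (⊖-self S)

injective⇒surjective : ∀ {n} {f : Fin n → Fin n} → Injective _≡_ _≡_ f → ∀ j → ∃ λ i → f i ≡ j
injective⇒surjective {suc m} {f} f-inj j with any? (λ i → f i ≟ j)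
... | yes hit  = hit
... | no  miss = contradiction (injective⇒≤ squeezed-injective) ℕ.1+n≰n
  where
  misses : ∀ i → j ≢ f i
  misses i j≡fi = miss (i , ≡.sym j≡fi)
  squeezed-injective : Injective _≡_ _≡_ (λ i → punchOut (misses i))
  squeezed-injective eq = f-inj (punchOut-injective (misses _) (misses _) eq)

surjective⇒injective : ∀ {n} {f : Fin n → Fin n} → (∀ j → ∃ λ i → f i ≡ j) → Injective _≡_ _≡_ f
surjective⇒injective {n} {f} f-surj {a} {b} fa≡fb =
  ≡.trans (≡.sym (retraction a)) (≡.trans (≡.cong section fa≡fb) (retraction b))
  where
  section : Fin n → Fin n
  section j = proj₁ (f-surj j)
  section-injective : Injective _≡_ _≡_ section
  section-injective {j} {k} eq =
    ≡.trans (≡.sym (proj₂ (f-surj j))) (≡.trans (≡.cong f eq) (proj₂ (f-surj k)))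
  retraction : ∀ a → section (f a) ≡ a
  retraction a with injective⇒surjective section-injective a
  ... | j , ≡.refl = ≡.cong section (proj₂ (f-surj j))

injective⇒isPerm : ∀ {n} {f : Fin n → Fin n} → Injective _≡_ _≡_ f → isPerm f ≡ true
injective⇒isPerm {n} {f} f-inj = allᵇ-true⁺ λ i → allᵇ-true⁺ λ j → entry i j
  where
  entry : ∀ i j → does (i ≟ j) ∨ not (does (f i ≟ f j)) ≡ true
  entry i j with i ≟ j
  ... | yes _   = ≡.refl
  ... | no  i≢j = ≡.cong not (dec-false (f i ≟ f j) (λ fi≡fj → i≢j (f-inj fi≡fj)))

isPerm⇒injective : ∀ {n} {f : Fin n → Fin n} → isPerm f ≡ true → Injective _≡_ _≡_ f
isPerm⇒injective {n} {f} perm {i} {j} fi≡fj with i ≟ j | allᵇ-true⁻ (allᵇ-true⁻ perm i) j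
... | yes i≡j | _     = i≡j
... | no  _   | entry = contradiction (≡.trans (≡.sym entry) (≡.cong not (dec-true (f i ≟ f j) fi≡fj))) λ ()

module Compatibility {n} (f : Fin n → Fin n) where
  open ≡.≡-Reasoning
  open RingSums 𝔹 using (∑-map-cong; ∑-allSubsets-∏; module Π)

  compatible : Subset n → Bool
  compatible S = allᵇ n λ i → lookup (S ⊖ ⁅ i ⁆) (f i)

  -- Whether b = (j ∈ S) is consistent with f i ∈ S ⊖ {i} for every i in the fibre of j.
  column : Fin n → Bool → Bool
  column j b = allᵇ n λ i → not (does (f i ≟ j)) ∨ (b xor does (i ≟ j))

  compatible-byColumns : ∀ S → compatible S ≡ allᵇ n λ j → column j (lookup S j)
  compatible-byColumns S = begin
    allᵇ n (λ i → lookup (S ⊖ ⁅ i ⁆) (f i))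
      ≡⟨ Π.∑-map-cong (λ i → lookup-allᵇ (S ⊖ ⁅ i ⁆) (f i)) (allFin n) ⟩
    allᵇ n (λ i → allᵇ n λ j → not (does (f i ≟ j)) ∨ lookup (S ⊖ ⁅ i ⁆) j)
      ≡⟨ Π.∑-map-cong (λ i → Π.∑-map-cong (λ j → ≡.cong (not (does (f i ≟ j)) ∨_) (entry i j)) (allFin n)) (allFin n) ⟩
    allᵇ n (λ i → allᵇ n λ j → not (does (f i ≟ j)) ∨ (lookup S j xor does (i ≟ j)))
      ≡⟨ Π.∑-map-comm (λ i j → not (does (f i ≟ j)) ∨ (lookup S j xor does (i ≟ j))) (allFin n) (allFin n) ⟩
    allᵇ n (λ j → column j (lookup S j)) ∎
    where
    entry : ∀ i j → lookup (S ⊖ ⁅ i ⁆) j ≡ lookup S j xor does (i ≟ j)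
    entry i j = ≡.trans (lookup-⊖ S ⁅ i ⁆ j) (≡.cong (lookup S j xor_) (lookup-⁅⁆ i j))

  compatible-⁅⁆ : ∀ k → compatible ⁅ k ⁆ ≡ false
  compatible-⁅⁆ k = allᵇ-false⁺ k (begin
    lookup (⁅ k ⁆ ⊖ ⁅ k ⁆) (f k) ≡⟨ ≡.cong (λ S → lookup S (f k)) (⊖-self ⁅ k ⁆) ⟩
    lookup ⊥ (f k)               ≡⟨ Vec.lookup-replicate (f k) outside ⟩
    false                        ∎)

  column-true⁺ : ∀ j b → (∀ i → f i ≡ j → b xor does (i ≟ j) ≡ true) → column j b ≡ true
  column-true⁺ j b all = allᵇ-true⁺ entry
    where
    entry : ∀ i → not (does (f i ≟ j)) ∨ (b xor does (i ≟ j)) ≡ true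
    entry i with f i ≟ j
    ... | yes fi≡j = all i fi≡j
    ... | no  _    = ≡.refl

  column-false⁺ : ∀ j b i → f i ≡ j → b xor does (i ≟ j) ≡ false → column j b ≡ false
  column-false⁺ j b i fi≡j bit≡false = allᵇ-false⁺ i entry
    where
    entry : not (does (f i ≟ j)) ∨ (b xor does (i ≟ j)) ≡ false
    entry with f i ≟ j
    ... | yes _    = bit≡false
    ... | no  fi≢j = contradiction fi≡j fi≢j

  columnParity : Fin n → Bool
  columnParity j = column j false xor column j true

  injective⇒columnParity : Injective _≡_ _≡_ f → ∀ j → columnParity j ≡ true
  injective⇒columnParity f-inj j with f j ≟ j
  ... | yes fj≡j = ≡.cong₂ _xor_ fibre⊆⁅j⁆ (column-false⁺ j true j fj≡j (≡.cong not (dec-true (j ≟ j) ≡.refl)))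
    where
    fibre⊆⁅j⁆ : column j false ≡ true
    fibre⊆⁅j⁆ = column-true⁺ j false λ i fi≡j → dec-true (i ≟ j) (f-inj (≡.trans fi≡j (≡.sym fj≡j)))
  ... | no  fj≢j with injective⇒surjective f-inj j
  ...   | i , fi≡j = ≡.cong₂ _xor_ (column-false⁺ j false i fi≡j (dec-false (i ≟ j) (≢j i fi≡j))) j∉fibre
    where
    ≢j : ∀ i → f i ≡ j → i ≢ j
    ≢j i fi≡j ≡.refl = fj≢j fi≡j
    j∉fibre : column j true ≡ true
    j∉fibre = column-true⁺ j true λ i fi≡j → ≡.cong not (dec-false (i ≟ j) (≢j i fi≡j))

  columnParity⇒surjective : allᵇ n columnParity ≡ true → ∀ j → ∃ λ i → f i ≡ j
  columnParity⇒surjective parity j with any? (λ i → f i ≟ j)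
  ... | yes hit  = hit
  ... | no  miss = contradiction (≡.trans (≡.sym (allᵇ-true⁻ parity j)) (≡.cong₂ _xor_ (vacuous false) (vacuous true))) λ ()
    where
    vacuous : ∀ b → column j b ≡ true
    vacuous b = column-true⁺ j b λ i fi≡j → contradiction (i , fi≡j) miss

  allᵇ-columnParity : allᵇ n columnParity ≡ isPerm f
  allᵇ-columnParity = true⇔true⇒≡
    (λ parity → injective⇒isPerm (surjective⇒injective (columnParity⇒surjective parity)))
    (λ perm → allᵇ-true⁺ (injective⇒columnParity (isPerm⇒injective perm)))

  parity-compatible : sumL 𝔹 (map compatible (allSubsets n)) ≡ isPerm f
  parity-compatible = begin
    sumL 𝔹 (map compatible (allSubsets n))
      ≡⟨ ∑-map-cong compatible-byColumns (allSubsets n) ⟩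
    sumL 𝔹 (map (λ S → allᵇ n λ j → column j (lookup S j)) (allSubsets n))
      ≡⟨ ∑-allSubsets-∏ n column ⟩
    allᵇ n columnParity
      ≡⟨ allᵇ-columnParity ⟩
    isPerm f ∎

isEmptyᵇ : ∀ {n} → Subset n → Bool
isEmptyᵇ []          = true
isEmptyᵇ (true  ∷ S) = false
isEmptyᵇ (false ∷ S) = isEmptyᵇ S

isSingletonᵇ : ∀ {n} → Subset n → Bool
isSingletonᵇ []          = false
isSingletonᵇ (true  ∷ S) = isEmptyᵇ S
isSingletonᵇ (false ∷ S) = isSingletonᵇ S

isEmptyᵇ⇒≡⊥ : ∀ {n} (S : Subset n) → isEmptyᵇ S ≡ true → S ≡ ⊥
isEmptyᵇ⇒≡⊥ []          _     = ≡.refl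
isEmptyᵇ⇒≡⊥ (false ∷ S) empty = ≡.cong (false ∷_) (isEmptyᵇ⇒≡⊥ S empty)

isSingletonᵇ⇒≡⁅⁆ : ∀ {n} (S : Subset n) → isSingletonᵇ S ≡ true → ∃ λ k → S ≡ ⁅ k ⁆
isSingletonᵇ⇒≡⁅⁆ (true  ∷ S) single = zero , ≡.cong (true ∷_) (isEmptyᵇ⇒≡⊥ S single)
isSingletonᵇ⇒≡⁅⁆ (false ∷ S) single with isSingletonᵇ⇒≡⁅⁆ S single
... | k , S≡⁅k⁆ = suc k , ≡.cong (false ∷_) S≡⁅k⁆

nonSingletons : ∀ n → List (Subset n)
nonSingletons n = filterᵇ (λ S → not (isSingletonᵇ S)) (allSubsets n)

module Counting where
  open Nat using (_+_)

  module _ {a} {A : Set a} where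

    count : (A → Bool) → List A → ℕ
    count p xs = List.length (filterᵇ p xs)

    count-true : ∀ xs → count (λ _ → true) xs ≡ List.length xs
    count-true []       = ≡.refl
    count-true (x ∷ xs) = ≡.cong suc (count-true xs)

    count-false : ∀ xs → count (λ _ → false) xs ≡ 0
    count-false []       = ≡.refl
    count-false (x ∷ xs) = count-false xs

    count-complement : ∀ p xs → count p xs + count (λ x → not (p x)) xs ≡ List.length xs
    count-complement p []       = ≡.refl
    count-complement p (x ∷ xs) with p x
    ... | true  = ≡.cong suc (count-complement p xs)
    ... | false = ≡.trans (ℕ.+-suc _ _) (≡.cong suc (count-complement p xs))

  count-allSubsets-suc : ∀ n (p : Subset (suc n) → Bool) →
    count p (allSubsets (suc n)) ≡ count (λ S → p (outside ∷ S)) (allSubsets n) + count (λ S → p (inside ∷ S)) (allSubsets n)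
  count-allSubsets-suc n p = go (allSubsets n)
    where
    go : ∀ xs → count p (concatMap (λ S → (outside ∷ S) ∷ (inside ∷ S) ∷ []) xs)
                ≡ count (λ S → p (outside ∷ S)) xs + count (λ S → p (inside ∷ S)) xs
    go []       = ≡.refl
    go (S ∷ xs) with p (outside ∷ S)
    ... | true with p (inside ∷ S)
    ...   | true  = ≡.cong suc (≡.trans (≡.cong suc (go xs)) (≡.sym (ℕ.+-suc _ _)))
    ...   | false = ≡.cong suc (go xs)
    go (S ∷ xs) | false with p (inside ∷ S)
    ...   | true  = ≡.trans (≡.cong suc (go xs)) (≡.sym (ℕ.+-suc _ _))
    ...   | false = go xs

  length-allSubsets : ∀ n → List.length (allSubsets n) ≡ 2 ^ n
  length-allSubsets zero    = ≡.refl
  length-allSubsets (suc n) = begin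
    List.length (allSubsets (suc n))                              ≡⟨ count-true (allSubsets (suc n)) ⟨
    count (λ _ → true) (allSubsets (suc n))                       ≡⟨ count-allSubsets-suc n _ ⟩
    count (λ _ → true) (allSubsets n) + count (λ _ → true) (allSubsets n)
      ≡⟨ ≡.cong₂ _+_ (≡.trans (count-true (allSubsets n)) (length-allSubsets n)) (≡.trans (count-true (allSubsets n)) (length-allSubsets n)) ⟩
    2 ^ n + 2 ^ n                                                 ≡⟨ ≡.cong (2 ^ n +_) (ℕ.+-identityʳ (2 ^ n)) ⟨
    2 ^ suc n                                                     ∎
    where open ≡.≡-Reasoning

  count-isEmptyᵇ : ∀ n → count isEmptyᵇ (allSubsets n) ≡ 1
  count-isEmptyᵇ zero    = ≡.refl
  count-isEmptyᵇ (suc n) = ≡.trans (count-allSubsets-suc n isEmptyᵇ)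
    (≡.cong₂ _+_ (count-isEmptyᵇ n) (count-false (allSubsets n)))

  count-isSingletonᵇ : ∀ n → count isSingletonᵇ (allSubsets n) ≡ n
  count-isSingletonᵇ zero    = ≡.refl
  count-isSingletonᵇ (suc n) = ≡.trans (count-allSubsets-suc n isSingletonᵇ)
    (≡.trans (≡.cong₂ _+_ (count-isSingletonᵇ n) (count-isEmptyᵇ n)) (ℕ.+-comm n 1))

  length-nonSingletons : ∀ n → List.length (nonSingletons n) ≡ 2 ^ n ∸ n
  length-nonSingletons n = begin
    List.length (nonSingletons n)                  ≡⟨ ℕ.m+n∸n≡m (List.length (nonSingletons n)) n ⟨
    List.length (nonSingletons n) + n ∸ n          ≡⟨ ≡.cong (λ k → k ∸ n) partition ⟩
    2 ^ n ∸ n                                      ∎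
    where
    open ≡.≡-Reasoning
    partition : List.length (nonSingletons n) + n ≡ 2 ^ n
    partition = begin
      List.length (nonSingletons n) + n                                      ≡⟨ ℕ.+-comm _ n ⟩
      n + List.length (nonSingletons n)                                      ≡⟨ ≡.cong (_+ List.length (nonSingletons n)) (count-isSingletonᵇ n) ⟨
      count isSingletonᵇ (allSubsets n) + List.length (nonSingletons n)      ≡⟨ count-complement isSingletonᵇ (allSubsets n) ⟩
      List.length (allSubsets n)                                             ≡⟨ length-allSubsets n ⟩
      2 ^ n                                                                  ∎

open Counting using (length-nonSingletons)

module Expansions {c ℓ} (R : CommutativeRing c ℓ) where
  open CommutativeRing R hiding (zero)
  open RingSums R
  open SetoidReasoning setoid
  open Compatibility using (compatible)

  RankLE-resp-≈ᵀ : ∀ {n} {T U : Tensor R n} {r} → _≈ᵀ_ R T U → RankLE R T r → RankLE R U r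
  RankLE-resp-≈ᵀ T≈U (vs , T≈∑) = vs , λ f → trans (sym (T≈U f)) (T≈∑ f)

  RankLE-fromList : ∀ {a} {X : Set a} {n} {T : Tensor R n} (v : X → Fin n → Fin n → Carrier) xs →
    _≈ᵀ_ R T (λ f → ∑ (map (λ x → elementary R (v x) f) xs)) → RankLE R T (List.length xs)
  RankLE-fromList v xs T≈∑ = (λ t → v (List.lookup xs t)) , λ f → trans (T≈∑ f) (reflexive (≡.sym (reindex f)))
    where
    reindex : ∀ f → Σ[< R ] (List.length xs) (λ t → elementary R (v (List.lookup xs t)) f)
                  ≡ ∑ (map (λ x → elementary R (v x) f) xs)
    reindex f = ≡.cong ∑ (≡.trans (List.map-tabulate (λ t → t) _)
                         (≡.trans (≡.sym (List.map-tabulate (List.lookup xs) _))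
                                  (≡.cong (map _) (List.tabulate-lookup xs))))

  module _ {n} (A : Matrix R n) where

    monomial : (Fin n → Fin n) → Carrier
    monomial f = ∏[< R ] n λ i → A i (f i)

    per-expansion : per R A ≈ ∑ (map (λ f → ⟦ isPerm f ⟧ * monomial f) (allFuns n n))
    per-expansion = begin
      ∑ (map monomial (filterᵇ isPerm (allFuns n n)))
        ≈⟨ ∑-filterᵇ monomial isPerm (allFuns n n) ⟩
      ∑ (map (λ f → if isPerm f then monomial f else 0#) (allFuns n n))
        ≈⟨ ∑-map-cong (λ f → ⟦⟧-if (isPerm f) (monomial f)) (allFuns n n) ⟩
      ∑ (map (λ f → ⟦ isPerm f ⟧ * monomial f) (allFuns n n)) ∎

    subsetFormula-expansion : subsetFormula R A ≈
      ∑ (map (λ f → ∑ (map (λ S → ⟦ compatible f S ⟧) (allSubsets n)) * monomial f) (allFuns n n))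
    subsetFormula-expansion = begin
      ∑ (map (λ S → ∏[< R ] n λ i → Σ[< R ] n λ j → entry S i j) (allSubsets n))
        ≈⟨ ∑-map-cong (λ S → ∏-∑-allFuns n n (entry S)) (allSubsets n) ⟩
      ∑ (map (λ S → ∑ (map (λ f → ∏[< R ] n λ i → entry S i (f i)) (allFuns n n))) (allSubsets n))
        ≈⟨ ∑-map-cong (λ S → ∑-map-cong (λ f → ∏-if n _ (λ i → A i (f i))) (allFuns n n)) (allSubsets n) ⟩
      ∑ (map (λ S → ∑ (map (λ f → ⟦ compatible f S ⟧ * monomial f) (allFuns n n))) (allSubsets n))
        ≈⟨ ∑-map-comm (λ S f → ⟦ compatible f S ⟧ * monomial f) (allSubsets n) (allFuns n n) ⟩
      ∑ (map (λ f → ∑ (map (λ S → ⟦ compatible f S ⟧ * monomial f) (allSubsets n))) (allFuns n n))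
        ≈⟨ ∑-map-cong (λ f → ∑-distribʳ (monomial f) _ (allSubsets n)) (allFuns n n) ⟨
      ∑ (map (λ f → ∑ (map (λ S → ⟦ compatible f S ⟧) (allSubsets n)) * monomial f) (allFuns n n)) ∎
      where
      entry : Subset n → Fin n → Fin n → Carrier
      entry S i j = if lookup (S ⊖ ⁅ i ⁆) j then A i j else 0#

  indicators : ∀ {n} → Subset n → Fin n → Fin n → Carrier
  indicators S k j = ⟦ lookup (S ⊖ ⁅ k ⁆) j ⟧

  elementary-indicators : ∀ {n} (S : Subset n) f → elementary R (indicators S) f ≈ ⟦ compatible f S ⟧
  elementary-indicators {n} S f = sym (⟦⟧-∏ (λ k → lookup (S ⊖ ⁅ k ⁆) (f k)) (allFin n))

Characteristic2 : ∀ {c ℓ} → CommutativeRing c ℓ → Set ℓ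
Characteristic2 R = 1# + 1# ≈ 0#
  where open CommutativeRing R

module CharacteristicTwo {c ℓ} (R : CommutativeRing c ℓ) (1+1≈0 : Characteristic2 R) where
  open CommutativeRing R hiding (zero)
  open RingSums R
  open Expansions R
  open SetoidReasoning setoid
  open Compatibility using (compatible; compatible-⁅⁆; parity-compatible)

  x+x≈0 : ∀ x → x + x ≈ 0#
  x+x≈0 x = begin
    x + x             ≈⟨ +-cong (*-identityˡ x) (*-identityˡ x) ⟨
    1# * x + 1# * x   ≈⟨ distribʳ x 1# 1# ⟨
    (1# + 1#) * x     ≈⟨ *-congʳ 1+1≈0 ⟩
    0# * x            ≈⟨ zeroˡ x ⟩
    0#                ∎

  -1≈1 : - 1# ≈ 1#
  -1≈1 = begin
    - 1#                ≈⟨ +-identityʳ (- 1#) ⟨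
    - 1# + 0#           ≈⟨ +-congˡ 1+1≈0 ⟨
    - 1# + (1# + 1#)    ≈⟨ +-assoc (- 1#) 1# 1# ⟨
    (- 1# + 1#) + 1#    ≈⟨ +-congʳ (-‿inverseˡ 1#) ⟩
    0# + 1#             ≈⟨ +-identityˡ 1# ⟩
    1#                  ∎

  sgn≈1 : ∀ {n} (σ : Fin n → Fin n) → sgn R σ ≈ 1#
  sgn≈1 σ with does (inversions σ Nat.% 2 Nat.≟ 0)
  ... | true  = refl
  ... | false = -1≈1

  ⟦⟧-xor : ∀ a b → ⟦ a xor b ⟧ ≈ ⟦ a ⟧ + ⟦ b ⟧
  ⟦⟧-xor true  true  = sym (x+x≈0 1#)
  ⟦⟧-xor true  false = sym (+-identityʳ 1#)
  ⟦⟧-xor false b     = sym (+-identityˡ ⟦ b ⟧)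

  ⟦⟧-∑ : ∀ {a} {A : Set a} (p : A → Bool) xs → ⟦ sumL 𝔹 (map p xs) ⟧ ≈ ∑ (map (λ x → ⟦ p x ⟧) xs)
  ⟦⟧-∑ p []       = refl
  ⟦⟧-∑ p (x ∷ xs) = trans (⟦⟧-xor (p x) _) (+-congˡ (⟦⟧-∑ p xs))

  ∑-⟦compatible⟧ : ∀ {n} (f : Fin n → Fin n) → ∑ (map (λ S → ⟦ compatible f S ⟧) (allSubsets n)) ≈ ⟦ isPerm f ⟧
  ∑-⟦compatible⟧ {n} f = trans (sym (⟦⟧-∑ (compatible f) (allSubsets n))) (reflexive (≡.cong ⟦_⟧ (parity-compatible f)))

  module _ {n} (A : Matrix R n) where

    per≈det : per R A ≈ det R A
    per≈det = ∑-map-cong (λ σ → trans (sym (*-identityˡ _)) (*-congʳ (sym (sgn≈1 σ)))) (perms n)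

    per≈subsetFormula : per R A ≈ subsetFormula R A
    per≈subsetFormula = begin
      per R A
        ≈⟨ per-expansion A ⟩
      ∑ (map (λ f → ⟦ isPerm f ⟧ * monomial A f) (allFuns n n))
        ≈⟨ ∑-map-cong (λ f → *-congʳ (∑-⟦compatible⟧ f)) (allFuns n n) ⟨
      ∑ (map (λ f → ∑ (map (λ S → ⟦ compatible f S ⟧) (allSubsets n)) * monomial A f) (allFuns n n))
        ≈⟨ subsetFormula-expansion A ⟨
      subsetFormula R A ∎

  perTensor≈detTensor : ∀ n → _≈ᵀ_ R (perTensor R n) (detTensor R n)
  perTensor≈detTensor n f with isPerm f
  ... | true  = sym (sgn≈1 f)
  ... | false = refl

  perTensor≈∑nonSingletons : ∀ n → _≈ᵀ_ R (perTensor R n) (λ f → ∑ (map (λ S → elementary R (indicators S) f) (nonSingletons n)))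
  perTensor≈∑nonSingletons n f = begin
    ⟦ isPerm f ⟧
      ≈⟨ ∑-⟦compatible⟧ f ⟨
    ∑ (map (λ S → ⟦ compatible f S ⟧) (allSubsets n))
      ≈⟨ ∑-map-cong (λ S → elementary-indicators S f) (allSubsets n) ⟨
    ∑ (map (λ S → elementary R (indicators S) f) (allSubsets n))
      ≈⟨ ∑-filterᵇ-not isSingletonᵇ vanish (allSubsets n) ⟨
    ∑ (map (λ S → elementary R (indicators S) f) (nonSingletons n)) ∎
    where
    vanish : ∀ S → isSingletonᵇ S ≡ true → elementary R (indicators S) f ≈ 0#
    vanish S single with isSingletonᵇ⇒≡⁅⁆ S single
    ... | k , ≡.refl = trans (elementary-indicators ⁅ k ⁆ f) (reflexive (≡.cong ⟦_⟧ (compatible-⁅⁆ f k)))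

  RankLE-detTensor : ∀ n → RankLE R (detTensor R n) (2 ^ n ∸ n)
  RankLE-detTensor n = RankLE-resp-≈ᵀ (perTensor≈detTensor n)
    (≡.subst (RankLE R (perTensor R n)) (length-nonSingletons n)
             (RankLE-fromList indicators (nonSingletons n) (perTensor≈∑nonSingletons n)))

corollary5p4 : ∀ {c ℓ} (F : Field c ℓ) → Char2 F → (n : ℕ) →
    (A : Matrix (Field.commutativeRing F) n) →
    (Field._≈_ F (per (Field.commutativeRing F) A) (det (Field.commutativeRing F) A)
     × Field._≈_ F (det (Field.commutativeRing F) A) (subsetFormula (Field.commutativeRing F) A))
    × ((∀ r → RankLE (Field.commutativeRing F) (perTensor (Field.commutativeRing F) n) r
               ⇔ RankLE (Field.commutativeRing F) (detTensor (Field.commutativeRing F) n) r)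
       × RankLE (Field.commutativeRing F) (detTensor (Field.commutativeRing F) n) (2 ^ n ∸ n))
corollary5p4 F char2 n A =
  (per≈det A , trans (sym (per≈det A)) (per≈subsetFormula A)) ,
  (λ r → mk⇔ (RankLE-resp-≈ᵀ (perTensor≈detTensor n)) (RankLE-resp-≈ᵀ (λ f → sym (perTensor≈detTensor n f)))) ,
  RankLE-detTensor n
  where
  open Field F using (commutativeRing; sym; trans)
  open Expansions commutativeRing using (RankLE-resp-≈ᵀ)
  open CharacteristicTwo commutativeRing char2
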